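{- Let $G$ be a Nim sequence over an additively periodic sequence $(\mathcal{Y}_x)_{x\in\mathbb{N}}$ of finite subsets of $\mathbb{Z}$ with upper difference bound $M^+$, and let $d(x)=G(x)-x$. Then there exists $C\in\mathbb{N}$ such that $d(x)\le\max(0,M^+)$ for all $x\ge C$.
   Context: $\mathbb{N}=\{0,1,2,\dots\}$. For a finite $Y\subseteq\mathbb{Z}$, $\operatorname{mex}(Y)=\min(\mathbb{N}\setminus Y)$. $(\mathcal{Y}_x)$ is additively periodic if there is $p\ge1$ with $\mathcal{Y}_{x+p}=\mathcal{Y}_x+p$ for all $x\in\mathbb{N}$. $M^+=\max\{z-x: x\in\mathbb{N}, z\in\mathcal{Y}_x\}+1$. A Nim sequence over $(\mathcal{Y}_x)$ with seed $[g_0,\dots,g_{L-1}]$ ($L\in\mathbb{N}$, $g_i\in\mathbb{N}$ pairwise distinct) is $G:\mathbb{N}\to\mathbb{N}$ with $G(x)=g_x$ for $x<L$ and $G(x)=\operatorname{mex}(\{G(x'):x'<x\}\cup\mathcal{Y}_x)$ for $x\ge L$. -}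

module Defs where

open import Data.Nat using (ℕ; _<_; _≤_; _≥_)
open import Data.Integer as ℤ using (ℤ; +_; _-_; _⊔_)
open import Data.List using (List; length; lookup)
open import Data.List.Membership.Propositional using (_∈_)
open import Data.List.Relation.Unary.Unique.Propositional using (Unique)
open import Data.Fin using (fromℕ<)
open import Data.Product using (Σ; ∃; _×_)
open import Data.Sum using (_⊎_)
open import Relation.Nullary using (¬_)
open import Relation.Binary.PropositionalEquality using (_≡_)
open import Function.Bundles using (_⇔_)

SetSeq : Set
SetSeq = ℕ → List ℤ

AdditivelyPeriodic : SetSeq → Set
AdditivelyPeriodic Y =
  Σ ℕ λ p → (1 ≤ p) ×
    (∀ (x : ℕ) (z : ℤ) →
      (z ∈ Y (x Data.Nat.+ p)) ⇔ (Σ ℤ λ w → (w ∈ Y x) × (z ≡ w ℤ.+ + p)))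

-- M is M⁺ = max{z - x : x ∈ ℕ, z ∈ 𝒴_x} + 1.
-- If every 𝒴_x is empty the max is over the empty set (= -∞); only max(0, M⁺)
-- is used in the theorem, so we then take M = 0 (which gives max(0,M⁺) = 0).
IsUpperDiffBound : SetSeq → ℤ → Set
IsUpperDiffBound Y M =
  ((∀ (x : ℕ) (z : ℤ) → z ∈ Y x → (z - + x) ℤ.+ + 1 ℤ.≤ M) ×
   (Σ ℕ λ x → Σ ℤ λ z → (z ∈ Y x) × ((z - + x) ℤ.+ + 1 ≡ M)))
  ⊎ ((∀ (x : ℕ) (z : ℤ) → ¬ (z ∈ Y x)) × (M ≡ + 0))

IsMex : (ℤ → Set) → ℕ → Set
IsMex S m = ¬ S (+ m) × (∀ k → k < m → S (+ k))

IsNimSeq : SetSeq → List ℕ → (ℕ → ℕ) → Set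
IsNimSeq Y g G =
  Unique g ×
  (∀ x → (h : x < length g) → G x ≡ lookup g (fromℕ< h)) ×
  (∀ x → x ≥ length g →
     IsMex (λ z → (Σ ℕ λ x' → (x' < x) × (z ≡ + G x')) ⊎ (z ∈ Y x)) (G x))

d : (ℕ → ℕ) → ℕ → ℤ
d G x = + G x - + x

-- Let B = max(0, M⁺). Every element z of 𝒴ₓ satisfies z < x + B, and by
-- periodicity also z ≥ x − D for a constant D. Past the seed, G(x) > x + B
-- forces every number in [x + B, G(x)) to be an earlier value, so the potential
-- Φ(x) = Σ_{i<x} max(0, G(i) + 1 − (x + B)) never increases, and it drops at
-- every x with G(x) ≤ x + B unless it is already 0. Such an x occurs in every
-- window of D + 2 arguments: otherwise a value m ≤ x missed by G on [0, x)
-- (pigeonhole) lies below G(x + D + 1) without being an earlier value or an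
-- element of 𝒴_{x+D+1}. Hence Φ reaches 0, and Φ(x + 1) = 0 means G(x) ≤ x + B.
module Submission where

open import Defs

module _ where
  open import Data.Nat
  open import Data.Nat.Properties
  open import Data.Nat.ListAction using (sum)
  import Data.Fin as Fin
  import Data.Fin.Properties as Fin
  open import Data.List.Membership.Propositional using (_∈_)
  open import Data.List.Relation.Unary.Any using (here; there)
  open import Data.Product using (∃-syntax; _×_; _,_; proj₁; proj₂)
  open import Data.Sum using (_⊎_; inj₁; inj₂; [_,_]′)
  open import Function using (_∘_)
  open import Relation.Nullary using (¬_; Dec; ¬?; yes; no; contradiction)
  open import Relation.Nullary.Decidable using (decidable-stable)
  open import Relation.Binary.PropositionalEquality
  open import Algebra.Properties.CommutativeSemigroup +-commutativeSemigroup
    using (interchange; x∙yz≈xz∙y)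

  sum< : ℕ → (ℕ → ℕ) → ℕ
  sum< zero    f = 0
  sum< (suc n) f = sum< n f + f n

  sum<-split : ∀ n {f g h : ℕ → ℕ} → (∀ i → h i ≡ f i + g i) →
               sum< n h ≡ sum< n f + sum< n g
  sum<-split zero    h≡f+g = refl
  sum<-split (suc n) {f} {g} {h} h≡f+g = begin
    sum< n h + h n                      ≡⟨ cong₂ _+_ (sum<-split n h≡f+g) (h≡f+g n) ⟩
    (sum< n f + sum< n g) + (f n + g n) ≡⟨ interchange (sum< n f) (sum< n g) (f n) (g n) ⟩
    (sum< n f + f n) + (sum< n g + g n) ∎
    where open ≡-Reasoning

  sum<-≡0 : ∀ n {f : ℕ → ℕ} → (∀ i → i < n → f i ≡ 0) → sum< n f ≡ 0
  sum<-≡0 zero    f≡0 = refl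
  sum<-≡0 (suc n) f≡0 =
    cong₂ _+_ (sum<-≡0 n (λ i i<n → f≡0 i (m<n⇒m<1+n i<n))) (f≡0 n (n<1+n n))

  ≤-sum< : ∀ {n i} (f : ℕ → ℕ) → i < n → f i ≤ sum< n f
  ≤-sum< {suc n} f i<1+n with m<1+n⇒m<n∨m≡n i<1+n
  ... | inj₁ i<n  = ≤-trans (≤-sum< f i<n) (m≤m+n _ (f n))
  ... | inj₂ refl = m≤n+m (f n) _

  ∈⇒≤sum : ∀ {n ns} → n ∈ ns → n ≤ sum ns
  ∈⇒≤sum (here refl)   = m≤m+n _ _
  ∈⇒≤sum (there n∈ns) = ≤-trans (∈⇒≤sum n∈ns) (m≤n+m _ _)

  𝟙[_≤_] : ℕ → ℕ → ℕ
  𝟙[ zero  ≤ v     ] = 1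
  𝟙[ suc a ≤ zero  ] = 0
  𝟙[ suc a ≤ suc v ] = 𝟙[ a ≤ v ]

  1+m∸n≡m∸n+𝟙[n≤m] : ∀ n m → suc m ∸ n ≡ m ∸ n + 𝟙[ n ≤ m ]
  1+m∸n≡m∸n+𝟙[n≤m] zero    m       = +-comm 1 m
  1+m∸n≡m∸n+𝟙[n≤m] (suc n) zero    = 0∸n≡0 n
  1+m∸n≡m∸n+𝟙[n≤m] (suc n) (suc m) = 1+m∸n≡m∸n+𝟙[n≤m] n m

  𝟙-antitone : ∀ n m → 𝟙[ suc n ≤ m ] ≤ 𝟙[ n ≤ m ]
  𝟙-antitone zero    zero    = z≤n
  𝟙-antitone zero    (suc m) = ≤-refl
  𝟙-antitone (suc n) zero    = z≤n
  𝟙-antitone (suc n) (suc m) = 𝟙-antitone n m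

  𝟙[n≤n]≡1 : ∀ n → 𝟙[ n ≤ n ] ≡ 1
  𝟙[n≤n]≡1 zero    = refl
  𝟙[n≤n]≡1 (suc n) = 𝟙[n≤n]≡1 n

  𝟙[1+n≤n]≡0 : ∀ n → 𝟙[ suc n ≤ n ] ≡ 0
  𝟙[1+n≤n]≡0 zero    = refl
  𝟙[1+n≤n]≡0 (suc n) = 𝟙[1+n≤n]≡0 n

  𝟙[n≤m]≡0⇒m<n : ∀ n m → 𝟙[ n ≤ m ] ≡ 0 → m < n
  𝟙[n≤m]≡0⇒m<n (suc n) zero    _ = z<s
  𝟙[n≤m]≡0⇒m<n (suc n) (suc m) eq = s<s (𝟙[n≤m]≡0⇒m<n n m eq)

  m<n∸o⇒o+m<n : ∀ {m n o} → m < n ∸ o → o + m < n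
  m<n∸o⇒o+m<n {m} {n} {o} m<n∸o = begin-strict
    o + m       <⟨ +-monoʳ-< o m<n∸o ⟩
    o + (n ∸ o) ≡⟨ m+[n∸m]≡n {o} (<⇒≤ (m∸n≢0⇒n<m (m<n⇒n≢0 m<n∸o))) ⟩
    n           ∎
    where open ≤-Reasoning

  stepwise-antitone : ∀ {L} (φ : ℕ → ℕ) → (∀ x → L ≤ x → φ (suc x) ≤ φ x) →
                      ∀ {x y} → L ≤ x → x ≤ y → φ y ≤ φ x
  stepwise-antitone φ step {y = zero}  L≤x z≤n = ≤-refl
  stepwise-antitone φ step {y = suc y} L≤x x≤1+y with m≤n⇒m<n∨m≡n x≤1+y
  ... | inj₁ (s≤s x≤y) = ≤-trans (step y (≤-trans L≤x x≤y)) (stepwise-antitone φ step L≤x x≤y)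
  ... | inj₂ refl      = ≤-refl

  module Counting (f : ℕ → ℕ) where

    Attained : ℕ → ℕ → Set
    Attained n k = ∃[ i ] i < n × k ≡ f i

    attained? : ∀ n k → Dec (Attained n k)
    attained? n k = anyUpTo? (λ i → k ≟ f i) n

    count≥ : ℕ → ℕ → ℕ
    count≥ a n = sum< n (λ i → 𝟙[ a ≤ f i ])

    count≥-antitone : ∀ a n → count≥ (suc a) n ≤ count≥ a n
    count≥-antitone a zero    = z≤n
    count≥-antitone a (suc n) = +-mono-≤ (count≥-antitone a n) (𝟙-antitone a (f n))

    count≥-attained : ∀ a n → Attained n a → count≥ (suc a) n < count≥ a n
    count≥-attained a (suc n) (i , i<1+n , a≡fi) with m<1+n⇒m<n∨m≡n i<1+n
    ... | inj₁ i<n =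
      +-mono-<-≤ (count≥-attained a n (i , i<n , a≡fi)) (𝟙-antitone a (f n))
    ... | inj₂ refl rewrite a≡fi = begin-strict
      count≥ (suc (f n)) n + 𝟙[ suc (f n) ≤ f n ] ≡⟨ cong (count≥ (suc (f n)) n +_) (𝟙[1+n≤n]≡0 (f n)) ⟩
      count≥ (suc (f n)) n + 0                   ≡⟨ +-identityʳ _ ⟩
      count≥ (suc (f n)) n                       <⟨ s≤s (count≥-antitone (f n) n) ⟩
      suc (count≥ (f n) n)                       ≡⟨ +-comm 1 _ ⟩
      count≥ (f n) n + 1                         ≡⟨ cong (count≥ (f n) n +_) (𝟙[n≤n]≡1 (f n)) ⟨
      count≥ (f n) n + 𝟙[ f n ≤ f n ]            ∎
      where open ≤-Reasoning

    count≥-block : ∀ m a n → (∀ j → j < m → Attained n (a + j)) → m ≤ count≥ a n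
    count≥-block zero    a n block = z≤n
    count≥-block (suc m) a n block = ≤-trans
      (s≤s (count≥-block m (suc a) n (λ j j<m →
        subst (Attained n) (+-suc a j) (block (suc j) (s<s j<m)))))
      (count≥-attained a n (subst (Attained n) (+-identityʳ a) (block 0 z<s)))

    count≥≡0⇒< : ∀ a n → count≥ a n ≡ 0 → ∀ i → i < n → f i < a
    count≥≡0⇒< a (suc n) count≡0 i i<1+n with m<1+n⇒m<n∨m≡n i<1+n
    ... | inj₁ i<n  = count≥≡0⇒< a n (m+n≡0⇒m≡0 _ count≡0) i i<n
    ... | inj₂ refl = 𝟙[n≤m]≡0⇒m<n a (f i) (m+n≡0⇒n≡0 (count≥ a i) count≡0)

    ¬attains-all : ∀ n → ¬ (∀ m → m < suc n → Attained n m)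
    ¬attains-all n attained =
      let k , k′ , k<k′ , same = Fin.pigeonhole (n<1+n n) preimage
      in <-irrefl (trans (image k) (trans (cong (f ∘ Fin.toℕ) same) (sym (image k′)))) k<k′
      where
      witness : ∀ k → Attained n (Fin.toℕ k)
      witness k = attained (Fin.toℕ k) (Fin.toℕ<n k)
      preimage : Fin.Fin (suc n) → Fin.Fin n
      preimage k = Fin.fromℕ< (proj₁ (proj₂ (witness k)))
      image : ∀ k → Fin.toℕ k ≡ f (Fin.toℕ (preimage k))
      image k = trans (proj₂ (proj₂ (witness k)))
                      (cong f (sym (Fin.toℕ-fromℕ< (proj₁ (proj₂ (witness k))))))

    missing-value : ∀ n → ∃[ m ] m ≤ n × ¬ Attained n m
    missing-value n with anyUpTo? (λ m → ¬? (attained? n m)) (suc n)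
    ... | yes (m , m<1+n , m-missing) = m , m<1+n⇒m≤n m<1+n , m-missing
    ... | no none-missing = contradiction
      (λ m m<1+n → decidable-stable (attained? n m) (λ ¬att → none-missing (m , m<1+n , ¬att)))
      (¬attains-all n)

  -- Forbidden x stands for 𝒴ₓ ∩ ℕ; only the covering half of the mex property is needed.
  module MexGrowth
    (G : ℕ → ℕ) (Forbidden : ℕ → ℕ → Set) (L B D : ℕ)
    (mex-covers : ∀ x → L ≤ x → ∀ k → k < G x → Counting.Attained G x k ⊎ Forbidden x k)
    (forbidden-< : ∀ x k → Forbidden x k → k < x + B)
    (forbidden-≥ : ∀ x k → Forbidden x k → x ≤ k + D)
    where

    open Counting G

    surplus : ℕ → ℕ
    surplus x = sum< x (λ i → G i ∸ (x + B))

    potential : ℕ → ℕ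
    potential x = sum< x (λ i → suc (G i) ∸ (x + B))

    potential-split : ∀ x → potential x ≡ surplus x + count≥ (x + B) x
    potential-split x = sum<-split x (λ i → 1+m∸n≡m∸n+𝟙[n≤m] (x + B) (G i))

    excess≤count≥ : ∀ x → L ≤ x → G x ∸ (x + B) ≤ count≥ (x + B) x
    excess≤count≥ x L≤x = count≥-block (G x ∸ (x + B)) (x + B) x block
      where
      block : ∀ j → j < G x ∸ (x + B) → Attained x (x + B + j)
      block j j<excess with mex-covers x L≤x (x + B + j) (m<n∸o⇒o+m<n j<excess)
      ... | inj₁ attained  = attained
      ... | inj₂ forbidden = contradiction (forbidden-< x _ forbidden) (m+n≮m (x + B) j)

    potential-step : ∀ x → L ≤ x → potential (suc x) ≤ potential x
    potential-step x L≤x = begin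
      potential (suc x)            ≡⟨⟩
      surplus x + (G x ∸ (x + B))  ≤⟨ +-monoʳ-≤ (surplus x) (excess≤count≥ x L≤x) ⟩
      surplus x + count≥ (x + B) x ≡⟨ potential-split x ⟨
      potential x                  ∎
      where open ≤-Reasoning

    potential-antitone : ∀ {x y} → L ≤ x → x ≤ y → potential y ≤ potential x
    potential-antitone = stepwise-antitone potential potential-step

    surplus≤pred[potential] : ∀ x → surplus x ≤ pred (potential x)
    surplus≤pred[potential] x rewrite potential-split x with count≥ (x + B) x in count≡
    ... | zero  rewrite sum<-≡0 x (λ i i<x → m≤n⇒m∸n≡0 (<⇒≤ (count≥≡0⇒< (x + B) x count≡ i i<x)))
                = z≤n
    ... | suc c rewrite +-suc (surplus x) c = m≤m+n (surplus x) c

    potential-drop : ∀ x → G x ≤ x + B → potential (suc x) ≤ pred (potential x)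
    potential-drop x Gx≤x+B = begin
      potential (suc x)           ≡⟨⟩
      surplus x + (G x ∸ (x + B)) ≡⟨ cong (surplus x +_) (m≤n⇒m∸n≡0 Gx≤x+B) ⟩
      surplus x + 0               ≡⟨ +-identityʳ (surplus x) ⟩
      surplus x                   ≤⟨ surplus≤pred[potential] x ⟩
      pred (potential x)          ∎
      where open ≤-Reasoning

    potential[1+x]≤0⇒G[x]≤x+B : ∀ x → potential (suc x) ≤ 0 → G x ≤ x + B
    potential[1+x]≤0⇒G[x]≤x+B x φ≤0 = m∸n≡0⇒m≤n (n≤0⇒n≡0 (≤-trans (m≤n+m _ (surplus x)) φ≤0))

    Overshoots : ℕ → Set
    Overshoots y = y + B < G y

    ¬long-overshoot : ∀ x → L ≤ x → ¬ (∀ j → j ≤ suc D → Overshoots (x + j))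
    ¬long-overshoot x L≤x overshoots with missing-value x
    ... | m , m≤x , m-missing =
      [ not-attained , not-forbidden ]′ (mex-covers y (≤-trans L≤x x≤y) m m<Gy)
      where
      y = x + suc D
      x≤y : x ≤ y
      x≤y = m≤m+n x (suc D)
      m<Gy : m < G y
      m<Gy = ≤-<-trans (≤-trans m≤x (≤-trans x≤y (m≤m+n y B))) (overshoots (suc D) ≤-refl)
      not-forbidden : ¬ Forbidden y m
      not-forbidden forbidden = <⇒≱ (+-mono-≤-< m≤x (n<1+n D)) (forbidden-≥ y m forbidden)
      not-attained : ¬ Attained y m
      not-attained (i , i<y , m≡Gi) with i <? x
      ... | yes i<x = m-missing (i , i<x , m≡Gi)
      ... | no  i≮x = <-irrefl m≡Gi (≤-<-trans (≤-trans m≤x (≤-trans x≤i (m≤m+n i B))) i-overshoots)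
        where
        x≤i = ≮⇒≥ i≮x
        i-overshoots : Overshoots i
        i-overshoots = subst Overshoots (m+[n∸m]≡n x≤i)
          (overshoots (i ∸ x) (subst (i ∸ x ≤_) (m+n∸m≡n x (suc D)) (∸-monoˡ-≤ x (<⇒≤ i<y))))

    overshoots? : ∀ y → Dec (Overshoots y)
    overshoots? y = y + B <? G y

    good-step-in-window : ∀ x → L ≤ x → ∃[ j ] j ≤ suc D × G (x + j) ≤ x + j + B
    good-step-in-window x L≤x with anyUpTo? (λ j → ¬? (overshoots? (x + j))) (suc (suc D))
    ... | yes (j , j<2+D , ¬overshoot) = j , m<1+n⇒m≤n j<2+D , ≮⇒≥ ¬overshoot
    ... | no no-good-step = contradiction
      (λ j j≤1+D → decidable-stable (overshoots? (x + j))
                     (λ ¬overshoot → no-good-step (j , s≤s j≤1+D , ¬overshoot)))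
      (¬long-overshoot x L≤x)

    window : ℕ
    window = suc (suc D)

    potential-window : ∀ x → L ≤ x → potential (x + window) ≤ pred (potential x)
    potential-window x L≤x with good-step-in-window x L≤x
    ... | j , j≤1+D , good = begin
      potential (x + window)   ≤⟨ potential-antitone (m≤n⇒m≤1+n L≤x+j) 1+x+j≤x+window ⟩
      potential (suc (x + j))  ≤⟨ potential-drop (x + j) good ⟩
      pred (potential (x + j)) ≤⟨ pred-mono-≤ (potential-antitone L≤x (m≤m+n x j)) ⟩
      pred (potential x)       ∎
      where
      open ≤-Reasoning
      L≤x+j = ≤-trans L≤x (m≤m+n x j)
      1+x+j≤x+window : suc (x + j) ≤ x + window
      1+x+j≤x+window = subst (_≤ x + window) (+-suc x j) (+-monoʳ-≤ x (s≤s j≤1+D))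

    potential-iterate : ∀ n x → L ≤ x → potential (x + n * window) ≤ potential x ∸ n
    potential-iterate zero    x L≤x = ≤-reflexive (cong potential (+-identityʳ x))
    potential-iterate (suc n) x L≤x = begin
      potential (x + (window + n * window)) ≡⟨ cong potential (x∙yz≈xz∙y x window (n * window)) ⟩
      potential (x + n * window + window)   ≤⟨ potential-window (x + n * window) (≤-trans L≤x (m≤m+n x _)) ⟩
      pred (potential (x + n * window))     ≤⟨ pred-mono-≤ (potential-iterate n x L≤x) ⟩
      pred (potential x ∸ n)                ≡⟨ pred[m∸n]≡m∸[1+n] (potential x) n ⟩
      potential x ∸ suc n                   ∎
      where open ≤-Reasoning

    eventually-below : ∃[ C ] ∀ x → C ≤ x → G x ≤ x + B
    eventually-below = C , λ x C≤x → potential[1+x]≤0⇒G[x]≤x+B x (begin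
      potential (suc x)         ≤⟨ potential-antitone (m≤m+n L _) (m≤n⇒m≤1+n C≤x) ⟩
      potential C               ≤⟨ potential-iterate (potential L) L ≤-refl ⟩
      potential L ∸ potential L ≡⟨ n∸n≡0 (potential L) ⟩
      0                         ∎)
      where
      open ≤-Reasoning
      C = L + potential L * window

open import Data.Nat using (ℕ; _≥_)
import Data.Nat as ℕ
import Data.Nat.Properties as ℕ
open import Data.Nat.ListAction using (sum)
open import Data.Nat.Induction using (<-rec)
open import Data.Integer using (ℤ; +_; -[1+_]; _+_; _-_; -_; ∣_∣; _≤_; _⊔_; +≤+)
import Data.Integer.Properties as ℤ
open import Data.List using (List; length; map)
open import Data.List.Membership.Propositional using (_∈_)
open import Data.List.Membership.Propositional.Properties using (∈-map⁺)
open import Data.Product using (Σ; ∃-syntax; _×_; _,_; proj₁; proj₂; map₂)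
open import Data.Sum using (inj₁; inj₂)
import Data.Sum as Sum
open import Data.Empty using (⊥-elim)
open import Function.Bundles using (Equivalence)
open import Relation.Nullary using (yes; no)
open import Relation.Binary.PropositionalEquality using (_≡_; sym; cong; subst)
open import Algebra.Properties.CommutativeSemigroup ℤ.+-commutativeSemigroup using (xy∙z≈xz∙y)
open import Algebra.Properties.AbelianGroup ℤ.+-0-abelianGroup using (xyx⁻¹≈y)
open import Data.Integer.Tactic.RingSolver using (solve-∀)

m+∣i∣≤n⇒+m≤i+n : ∀ {m n} i → m ℕ.+ ∣ i ∣ ℕ.≤ n → + m ≤ i + + n
m+∣i∣≤n⇒+m≤i+n {m} {n} (+ k) m+k≤n =
  +≤+ (ℕ.≤-trans (ℕ.≤-trans (ℕ.m≤m+n m k) m+k≤n) (ℕ.m≤n+m n k))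
m+∣i∣≤n⇒+m≤i+n {m} {n} -[1+ k ] m+1+k≤n =
  subst (+ m ≤_) (sym (ℤ.⊖-≥ (ℕ.≤-trans (ℕ.m≤n+m (ℕ.suc k) m) m+1+k≤n)))
    (+≤+ (ℕ.m+n≤o⇒m≤o∸n m m+1+k≤n))

periodic⇒lower-diff-bound : ∀ Y → AdditivelyPeriodic Y → ∃[ D ] ∀ x z → z ∈ Y x → + x ≤ z + + D
periodic⇒lower-diff-bound Y (p , 1≤p , period) = D , <-rec _ bound
  where
  -- Shifting by the period preserves z − x, so only x < p matters, and there
  -- ∣ z ∣ is at most the total size of 𝒴₀, …, 𝒴_{p−1}.
  size : ℕ → ℕ
  size r = sum (map ∣_∣ (Y r))
  D = p ℕ.+ sum< p size
  preimage : ∀ {x z} → p ℕ.≤ x → z ∈ Y x → ∃[ w ] w ∈ Y (x ℕ.∸ p) × z ≡ w + + p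
  preimage {x} {z} p≤x z∈Yx =
    Equivalence.to (period (x ℕ.∸ p) z) (subst (λ t → z ∈ Y t) (sym (ℕ.m∸n+n≡m p≤x)) z∈Yx)
  bound : ∀ x → (∀ {x′} → x′ ℕ.< x → ∀ z → z ∈ Y x′ → + x′ ≤ z + + D) →
          ∀ z → z ∈ Y x → + x ≤ z + + D
  bound x rec z z∈Yx with x ℕ.<? p
  ... | yes x<p = m+∣i∣≤n⇒+m≤i+n z (ℕ.+-mono-≤ (ℕ.<⇒≤ x<p)
          (ℕ.≤-trans (∈⇒≤sum (∈-map⁺ ∣_∣ z∈Yx)) (≤-sum< size x<p)))
  ... | no x≮p with preimage (ℕ.≮⇒≥ x≮p) z∈Yx
  ...   | w , w∈Y[x∸p] , z≡w+p = begin
    + x                    ≡⟨ cong +_ (ℕ.m∸n+n≡m (ℕ.≮⇒≥ x≮p)) ⟨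
    + (x ℕ.∸ p) + + p      ≤⟨ ℤ.+-monoˡ-≤ (+ p) (rec (ℕ.∸-monoʳ-< 1≤p (ℕ.≮⇒≥ x≮p)) w w∈Y[x∸p]) ⟩
    (w + + D) + + p        ≡⟨ xy∙z≈xz∙y w (+ D) (+ p) ⟩
    (w + + p) + + D        ≡⟨ cong (_+ + D) z≡w+p ⟨
    z + + D                ∎
    where open ℤ.≤-Reasoning

upper-diff-bound⇒< : ∀ {Y M} → IsUpperDiffBound Y M → ∀ x k → + k ∈ Y x → k ℕ.< x ℕ.+ ∣ + 0 ⊔ M ∣
upper-diff-bound⇒< (inj₂ (empty , _)) x k k∈Yx = ⊥-elim (empty x (+ k) k∈Yx)
upper-diff-bound⇒< {M = M} (inj₁ (below , _)) x k k∈Yx = ℤ.drop‿+≤+ (begin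
  + ℕ.suc k                    ≡⟨ cancel (+ x) (+ k) ⟨
  + x + ((+ k - + x) + + 1)    ≤⟨ ℤ.+-monoʳ-≤ (+ x) (ℤ.≤-trans (below x (+ k) k∈Yx) (ℤ.i≤j⊔i (+ 0) M)) ⟩
  + x + (+ 0 ⊔ M)              ≡⟨ cong (_+_ (+ x)) (ℤ.0≤i⇒+∣i∣≡i (ℤ.i≤i⊔j (+ 0) M)) ⟨
  + (x ℕ.+ ∣ + 0 ⊔ M ∣)        ∎)
  where
  open ℤ.≤-Reasoning
  cancel : ∀ x k → x + ((k - x) + + 1) ≡ + 1 + k
  cancel = solve-∀

lemmal : (Y : SetSeq) (g : List ℕ) (G : ℕ → ℕ) (M : ℤ) →
    AdditivelyPeriodic Y → IsUpperDiffBound Y M → IsNimSeq Y g G →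
    Σ ℕ λ C → ∀ x → x ≥ C → d G x ≤ (+ 0) ⊔ M
lemmal Y g G M periodic bounded (_ , _ , mex) =
  map₂ (λ below x C≤x → d-bound x (below x C≤x)) eventually-below
  where
  B = ∣ + 0 ⊔ M ∣
  lower = periodic⇒lower-diff-bound Y periodic
  covers : ∀ x → length g ℕ.≤ x → ∀ k → k ℕ.< G x →
           Counting.Attained G x k Sum.⊎ (+ k ∈ Y x)
  covers x L≤x k k<Gx = Sum.map₁ (map₂ (map₂ ℤ.+-injective)) (proj₂ (mex x L≤x) k k<Gx)
  open MexGrowth G (λ x k → + k ∈ Y x) (length g) B (proj₁ lower) covers
    (upper-diff-bound⇒< bounded) (λ x k k∈Yx → ℤ.drop‿+≤+ (proj₂ lower x (+ k) k∈Yx))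
  d-bound : ∀ x → G x ℕ.≤ x ℕ.+ B → d G x ≤ + 0 ⊔ M
  d-bound x Gx≤x+B = begin
    + G x - + x               ≤⟨ ℤ.+-monoˡ-≤ (- + x) (+≤+ Gx≤x+B) ⟩
    + x + + B - + x           ≡⟨ xyx⁻¹≈y (+ x) (+ B) ⟩
    + B                       ≡⟨ ℤ.0≤i⇒+∣i∣≡i (ℤ.i≤i⊔j (+ 0) M) ⟩
    + 0 ⊔ M                   ∎
    where open ℤ.≤-Reasoning
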